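{- Let $G_1$ and $G_2$ be graphs and let $H = G_1 \circ G_2$. A special subgraph $H_s$ of $H$ is a comparability graph if and only if its underlying lexicographic map is a comparability graph.
   Context: All graphs are simple, undirected and finite. A comparability graph is a graph admitting a transitive orientation. A graph is word-representable if there is a word $w$ over its vertex set such that two distinct vertices are adjacent iff their occurrences alternate in $w$. The lexicographic product $H = G_1 \circ G_2$ has vertex set $V(G_1)\times V(G_2)$, with $(u,v)$ and $(x,y)$ adjacent iff $\{u,x\}\in E(G_1)$, or $u=x$ and $\{v,y\}\in E(G_2)$. For $v_i \in V(G_1)$ the supervertex $V_i = \{(v_i,u) : u \in V(G_2)\}$. For a subgraph $G_1'$ of $G_1$, the lexicographic map $\mathcal{L}_H(G_1')$ is the subgraph of $H$ on vertex set $V(H)$ with no edges inside any supervertex and, for each edge $v_iv_j \in E(G_1')$, all edges between $V_i$ and $V_j$. A special subgraph of $H$ is any subgraph of $H$ obtained, for some word-representable subgraph $G_1'$ of $G_1$, from $\mathcal{L}_H(G_1')$ by adding edges of $H$ inside each supervertex $V_i$ such that the graph formed on $V_i$ by these added edges is a comparability graph (possibly with isolated vertices). The underlying lexicographic map of a special subgraph is the spanning subgraph obtained by deleting all edges inside supervertices. -}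

module Defs where

open import Data.Nat using (ℕ)
open import Data.Fin using (Fin; _≟_)
open import Data.Product using (Σ; Σ-syntax; _×_; _,_; proj₁; proj₂)
open import Data.Sum using (_⊎_)
open import Data.Unit using (⊤)
open import Data.List using (List; []; _∷_; filter)
open import Data.List.Membership.Propositional using (_∈_)
open import Relation.Nullary using (¬_)
open import Relation.Nullary.Decidable using (_⊎-dec_)
open import Relation.Binary.PropositionalEquality using (_≡_; _≢_)
open import Function using (_⇔_; Injective)

record Graph (V : Set) : Set₁ where
  field
    E      : V → V → Set
    sym    : ∀ {x y} → E x y → E y x
    irrefl : ∀ {x} → ¬ E x x
open Graph public

IsComparability : {V : Set} → Graph V → Set₁
IsComparability {V} G =
  Σ[ O ∈ (V → V → Set) ]
    ((∀ x y → E G x y ⇔ (O x y ⊎ O y x))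
    × (∀ x y → O x y → ¬ O y x)
    × (∀ x y z → O x y → O y z → O x z))

NoRepeat : {m : ℕ} → List (Fin m) → Set
NoRepeat []            = ⊤
NoRepeat (a ∷ [])      = ⊤
NoRepeat (a ∷ b ∷ l)   = (a ≢ b) × NoRepeat (b ∷ l)

-- x and y alternate in w: deleting all other letters yields xyxy... or yxyx...
Alternate : {m : ℕ} → Fin m → Fin m → List (Fin m) → Set
Alternate x y w = NoRepeat (filter (λ z → (z ≟ x) ⊎-dec (z ≟ y)) w)

WordRepresentable : {m : ℕ} → Graph (Fin m) → Set
WordRepresentable {m} G =
  Σ[ w ∈ List (Fin m) ]
    ((∀ v → v ∈ w) × (∀ x y → x ≢ y → (E G x y ⇔ Alternate x y w)))

-- A subgraph of G (up to isomorphism): a graph G' on Fin m with an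
-- injective edge-preserving vertex map into G.
record Subgraph {n : ℕ} (G : Graph (Fin n)) : Set₁ where
  field
    m     : ℕ
    graph : Graph (Fin m)
    emb   : Fin m → Fin n
    emb-injective : Injective _≡_ _≡_ emb
    emb-edge : ∀ {i j} → E graph i j → E G (emb i) (emb j)
open Subgraph public

-- Edge relation of the lexicographic map L_H(G1') on V(G1) × V(G2):
-- all edges between V_a and V_b for each edge of G1' (none inside supervertices).
LexMapEdge : {n₁ n₂ : ℕ} {G₁ : Graph (Fin n₁)} → Subgraph G₁ →
             Fin n₁ × Fin n₂ → Fin n₁ × Fin n₂ → Set
LexMapEdge S (u , _) (x , _) =
  Σ[ i ∈ Fin (m S) ] Σ[ j ∈ Fin (m S) ]
    (emb S i ≡ u × emb S j ≡ x × E (graph S) i j)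

-- Hs is a special subgraph of H = G1 ∘ G2: for some word-representable
-- subgraph G1' of G1 and, for each supervertex V_a, a comparability graph
-- C_a on V(G2) using only edges of G2 (i.e. edges of H inside V_a),
-- Hs has exactly the edges of L_H(G1') together with the edges of C_a in V_a.
IsSpecialSubgraph : {n₁ n₂ : ℕ} → Graph (Fin n₁) → Graph (Fin n₂) →
                    Graph (Fin n₁ × Fin n₂) → Set₁
IsSpecialSubgraph {n₁} {n₂} G₁ G₂ Hs =
  Σ[ S ∈ Subgraph G₁ ] (WordRepresentable (graph S) ×
  Σ[ C ∈ (Fin n₁ → Graph (Fin n₂)) ]
    ((∀ a → IsComparability (C a))
    × (∀ a v y → E (C a) v y → E G₂ v y)
    × (∀ p q → E Hs p q ⇔
         (LexMapEdge S p q ⊎ (proj₁ p ≡ proj₁ q × E (C (proj₁ p)) (proj₂ p) (proj₂ q))))))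

UnderlyingLexMap : {n₁ n₂ : ℕ} → Graph (Fin n₁ × Fin n₂) → Graph (Fin n₁ × Fin n₂)
UnderlyingLexMap Hs = record
  { E      = λ p q → E Hs p q × (proj₁ p ≢ proj₁ q)
  ; sym    = λ (e , ne) → sym Hs e , (λ eq → ne (Relation.Binary.PropositionalEquality.sym eq))
  ; irrefl = λ (e , _) → irrefl Hs e
  }

-- Hs and its underlying lexicographic map are lexicographic graphs over the same
-- quotient K, the image of G₁' in G₁: edges of K between supervertices, and C a
-- (resp. nothing) inside V_a. For such a graph with comparability fibres, a
-- transitive orientation restricts to one of K along a transversal, and conversely
-- orientations of K and of the fibres combine lexicographically. Hence each of the
-- two graphs is a comparability graph iff K is.
module Submission where

open import Defs
open import Data.Nat using (ℕ; zero; suc)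
open import Data.Fin as Fin using (Fin)
open import Data.Product using (Σ-syntax; _×_; _,_; proj₁; proj₂)
open import Data.Product.Function.NonDependent.Propositional using (_×-⇔_)
open import Data.Sum using (_⊎_; inj₁; inj₂)
open import Data.Empty using (⊥; ⊥-elim)
open import Relation.Nullary using (¬_)
open import Relation.Binary.PropositionalEquality as ≡ using (_≡_; _≢_; refl)
open import Function using (_⇔_; mk⇔; Equivalence)
open import Function.Construct.Composition using (_⇔-∘_)
open import Function.Construct.Identity using (⇔-id)
open import Function.Construct.Symmetry using (⇔-sym)
open import Function.Related.Propositional using (module EquationalReasoning)

open Equivalence

private
  variable
    A B V : Set

IsTransitiveOrientation : (E O : V → V → Set) → Set
IsTransitiveOrientation E O =
  (∀ x y → E x y ⇔ (O x y ⊎ O y x))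
  × (∀ x y → O x y → ¬ O y x)
  × (∀ x y z → O x y → O y z → O x z)

Comparable : (V → V → Set) → Set₁
Comparable {V} E = Σ[ O ∈ (V → V → Set) ] IsTransitiveOrientation E O

Edgeless : A → B → B → Set
Edgeless _ _ _ = ⊥

Lex : (A → A → Set) → (A → B → B → Set) → A × B → A × B → Set
Lex K F (a , u) (b , v) = K a b ⊎ (a ≡ b × F a u v)

Comparable-cong : {E E′ : V → V → Set} →
                  (∀ x y → E x y ⇔ E′ x y) → Comparable E ⇔ Comparable E′
Comparable-cong E⇔E′ = mk⇔ (transport E⇔E′) (transport (λ x y → ⇔-sym (E⇔E′ x y)))
  where
  transport : ∀ {E E′ : V → V → Set} →
              (∀ x y → E x y ⇔ E′ x y) → Comparable E → Comparable E′
  transport E⇔E′ (O , orients , asym , trans) =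
    O , (λ x y → orients x y ⇔-∘ ⇔-sym (E⇔E′ x y)) , asym , trans

Comparable-comap : {E : V → V → Set} (f : A → V) →
                   Comparable E → Comparable (λ a b → E (f a) (f b))
Comparable-comap f (O , orients , asym , trans) =
  (λ a b → O (f a) (f b)) ,
  (λ a b → orients (f a) (f b)) ,
  (λ a b → asym (f a) (f b)) ,
  (λ a b c → trans (f a) (f b) (f c))

Comparable-edgeless : Comparable {V} (λ _ _ → ⊥)
Comparable-edgeless = (λ _ _ → ⊥) , (λ _ _ → mk⇔ ⊥-elim λ { (inj₁ ()) ; (inj₂ ()) }) ,
                      (λ _ _ ()) , (λ _ _ _ ())

Comparable-empty : {E : V → V → Set} → ¬ V → Comparable E
Comparable-empty ¬v = to (Comparable-cong (λ x _ → mk⇔ ⊥-elim (λ _ → ¬v x))) Comparable-edgeless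

Comparable-Lex : {K : A → A → Set} {F : A → B → B → Set} →
                 Comparable K → (∀ a → Comparable (F a)) → Comparable (Lex K F)
Comparable-Lex {A = A} {B = B} {K = K} {F = F} (P , P-orients , P-asym , P-trans) F-comparable =
  Lex P Q , orients , asym , trans
  where
  Q : A → B → B → Set
  Q a = proj₁ (F-comparable a)

  Q-orients : ∀ a u v → F a u v ⇔ (Q a u v ⊎ Q a v u)
  Q-orients a = proj₁ (proj₂ (F-comparable a))

  Q-asym : ∀ a u v → Q a u v → ¬ Q a v u
  Q-asym a = proj₁ (proj₂ (proj₂ (F-comparable a)))

  Q-trans : ∀ a u v w → Q a u v → Q a v w → Q a u w
  Q-trans a = proj₂ (proj₂ (proj₂ (F-comparable a)))

  orients : ∀ x y → Lex K F x y ⇔ (Lex P Q x y ⊎ Lex P Q y x)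
  orients (a , u) (b , v) = mk⇔ orient unorient
    where
    orient : Lex K F (a , u) (b , v) → Lex P Q (a , u) (b , v) ⊎ Lex P Q (b , v) (a , u)
    orient (inj₁ k) with to (P-orients a b) k
    ... | inj₁ p = inj₁ (inj₁ p)
    ... | inj₂ p = inj₂ (inj₁ p)
    orient (inj₂ (refl , f)) with to (Q-orients a u v) f
    ... | inj₁ q = inj₁ (inj₂ (refl , q))
    ... | inj₂ q = inj₂ (inj₂ (refl , q))

    unorient : Lex P Q (a , u) (b , v) ⊎ Lex P Q (b , v) (a , u) → Lex K F (a , u) (b , v)
    unorient (inj₁ (inj₁ p))          = inj₁ (from (P-orients a b) (inj₁ p))
    unorient (inj₂ (inj₁ p))          = inj₁ (from (P-orients a b) (inj₂ p))
    unorient (inj₁ (inj₂ (refl , q))) = inj₂ (refl , from (Q-orients a u v) (inj₁ q))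
    unorient (inj₂ (inj₂ (refl , q))) = inj₂ (refl , from (Q-orients a u v) (inj₂ q))

  asym : ∀ x y → Lex P Q x y → ¬ Lex P Q y x
  asym (a , _) (b , _) (inj₁ p)          (inj₁ p′)        = P-asym a b p p′
  asym (a , _) (b , _) (inj₁ p)          (inj₂ (refl , _)) = P-asym a a p p
  asym (a , _) (b , _) (inj₂ (refl , _)) (inj₁ p)          = P-asym a a p p
  asym (a , u) (b , v) (inj₂ (refl , q)) (inj₂ (_ , q′))   = Q-asym a u v q q′

  trans : ∀ x y z → Lex P Q x y → Lex P Q y z → Lex P Q x z
  trans (a , _) (b , _) (c , _) (inj₁ p)          (inj₁ p′)          = inj₁ (P-trans a b c p p′)
  trans _       _       _       (inj₁ p)          (inj₂ (refl , _))  = inj₁ p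
  trans _       _       _       (inj₂ (refl , _)) (inj₁ p)           = inj₁ p
  trans (a , u) (b , v) (c , w) (inj₂ (refl , q)) (inj₂ (refl , q′)) = inj₂ (refl , Q-trans a u v w q q′)

Lex-transversal : {K : A → A → Set} {F : A → B → B → Set} (z : B) →
                  (∀ a → ¬ F a z z) → ∀ a b → Lex K F (a , z) (b , z) ⇔ K a b
Lex-transversal {K = K} {F = F} z F-irrefl a b = mk⇔ restrict inj₁
  where
  restrict : Lex K F (a , z) (b , z) → K a b
  restrict (inj₁ k)       = k
  restrict (inj₂ (_ , f)) = ⊥-elim (F-irrefl a f)

Comparable-Lex⇔ : {K : A → A → Set} {F : A → B → B → Set} (z : B) →
                  (∀ a u → ¬ F a u u) → (∀ a → Comparable (F a)) →
                  Comparable (Lex K F) ⇔ Comparable K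
Comparable-Lex⇔ {F = F} z F-irrefl F-comparable = mk⇔
  (λ c → to (Comparable-cong (Lex-transversal {F = F} z (λ a → F-irrefl a z)))
            (Comparable-comap (_, z) c))
  (λ c → Comparable-Lex c F-comparable)

Lex-between-fibres : {K : A → A → Set} {F : A → B → B → Set} →
                     (∀ {a b} → K a b → a ≢ b) →
                     ∀ x y → (Lex K F x y × proj₁ x ≢ proj₁ y) ⇔ Lex K Edgeless x y
Lex-between-fibres {K = K} {F = F} K-irrefl (a , u) (b , v) =
  mk⇔ forget (λ { (inj₁ k) → inj₁ k , K-irrefl k })
  where
  forget : Lex K F (a , u) (b , v) × a ≢ b → Lex K Edgeless (a , u) (b , v)
  forget (inj₁ k , _)           = inj₁ k
  forget (inj₂ (a≡b , _) , a≢b) = ⊥-elim (a≢b a≡b)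

ImageEdge : {n : ℕ} {G : Graph (Fin n)} → Subgraph G → Fin n → Fin n → Set
ImageEdge S a b =
  Σ[ i ∈ Fin (m S) ] Σ[ j ∈ Fin (m S) ] (emb S i ≡ a × emb S j ≡ b × E (graph S) i j)

ImageEdge-irrefl : {n : ℕ} {G : Graph (Fin n)} (S : Subgraph G) →
                   ∀ {a b} → ImageEdge S a b → a ≢ b
ImageEdge-irrefl S (i , j , refl , emb-j≡a , e) refl
  with emb-injective S (≡.sym emb-j≡a)
... | refl = irrefl (graph S) e

theorem7 : {n₁ n₂ : ℕ} (G₁ : Graph (Fin n₁)) (G₂ : Graph (Fin n₂))
           (Hs : Graph (Fin n₁ × Fin n₂)) →
           IsSpecialSubgraph G₁ G₂ Hs →
           (IsComparability Hs ⇔ IsComparability (UnderlyingLexMap Hs))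
theorem7 {n₂ = zero} _ _ _ _ =
  mk⇔ (λ _ → Comparable-empty λ { (_ , ()) }) (λ _ → Comparable-empty λ { (_ , ()) })
theorem7 {n₁} {suc _} _ _ Hs (S , _ , C , C-comparable , _ , Hs≅Lex) =
  begin
    Comparable (E Hs)                     ∼⟨ Comparable-cong Hs≅Lex ⟩
    Comparable (Lex K (λ a → E (C a)))    ∼⟨ Comparable-Lex⇔ Fin.zero (λ a _ → irrefl (C a)) C-comparable ⟩
    Comparable K                          ∼⟨ ⇔-sym (Comparable-Lex⇔ Fin.zero (λ _ _ ()) edgeless-fibres) ⟩
    Comparable (Lex K Edgeless)           ∼⟨ ⇔-sym (Comparable-cong U≅Lex) ⟩
    Comparable (E (UnderlyingLexMap Hs))  ∎
  where
  open EquationalReasoning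

  K : Fin n₁ → Fin n₁ → Set
  K = ImageEdge S

  edgeless-fibres : ∀ a → Comparable (Edgeless a)
  edgeless-fibres _ = Comparable-edgeless

  U≅Lex : ∀ x y → E (UnderlyingLexMap Hs) x y ⇔ Lex K Edgeless x y
  U≅Lex x y = Lex-between-fibres {F = λ a → E (C a)} (ImageEdge-irrefl S) x y
              ⇔-∘ (Hs≅Lex x y ×-⇔ ⇔-id _)
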